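{- Let $k$ be a positive integer, fix $i\in[k]$ and $s\ge0$, and let $\mathcal S$ be a $c$-good collection of independent difference equalities in the variables $x_1,\dots,x_i$, each containing $x_i$, with $|\mathcal S|\le s$. Then every subset of $\mathcal S$ which minimally implies some difference equality has size at most $4$.
   Context: Standing parameters: $\varepsilon,k_0,c$ satisfy $0<\varepsilon\le 1/4096$, $k_0\ge 32/\varepsilon^2$ and $2-\min\{\varepsilon^2/32,\,2/k_0\}\le c\le 2$. All linear equations are over $\mathbb Q$ in variables $x_1,\dots,x_k$, considered up to rearrangement but not scaling; the content of an equation is an expression $*$ with the equation reading $*=0$. Equations are independent if their contents are linearly independent; a collection implies an equation if its content is a $\mathbb Q$-linear combination of the contents of the collection, and minimally implies it if it implies it but no proper subset does. An equation contains a variable if its coefficient is nonzero. A difference equality is a nontrivial equation $x_{i_1}-x_{i_2}=x_{i_3}-x_{i_4}$ ($i_1,\dots,i_4\in[k]$ not necessarily distinct). A collection is valid if it does not imply $x_a=x_b$ for $a\ne b$; collinearity-free if it implies no equation containing exactly three variables; $c$-light if for every $t\ge1$ any $t$ independent equations it implies together contain at least $ct+1$ variables; $c$-good if valid, collinearity-free and $c$-light. -}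

module Defs where

open import Data.Nat as ℕ using (ℕ; zero; suc)
open import Data.Integer using (+_)
open import Data.Rational as ℚ using (ℚ; 0ℚ; 1ℚ; _+_; _*_; _-_; _/_; 1/_; _⊓_; _≤_; _<_; >-nonZero)
open import Data.Rational.Properties using (_≟_)
open import Data.Fin using (Fin; toℕ)
open import Data.Fin.Properties using (any?)
open import Data.Fin.Subset using (Subset; _∈_; _∉_; _⊂_; ⊤)
open import Data.Product using (Σ; ∃; _×_; _,_)
open import Data.Bool using (if_then_else_)
open import Relation.Nullary using (¬_; ¬?; does)
open import Relation.Binary.PropositionalEquality using (_≡_; _≢_)

-- A linear equation over ℚ in the variables x_1,…,x_k, represented by its
-- content: the coefficient vector (the equation reads  content = 0).
Eqn : ℕ → Set
Eqn k = Fin k → ℚ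

Σℚ : (m : ℕ) → (Fin m → ℚ) → ℚ
Σℚ zero    f = 0ℚ
Σℚ (suc m) f = f Fin.zero + Σℚ m (λ j → f (Fin.suc j))
  where import Data.Fin as Fin

Σℕ : (m : ℕ) → (Fin m → ℕ) → ℕ
Σℕ zero    f = 0
Σℕ (suc m) f = f Fin.zero ℕ.+ Σℕ m (λ j → f (Fin.suc j))
  where import Data.Fin as Fin

linComb : ∀ {k m} → (Fin m → ℚ) → (Fin m → Eqn k) → Eqn k
linComb {m = m} λs E v = Σℚ m (λ j → λs j * E j v)

Independent : ∀ {k m} → (Fin m → Eqn k) → Set
Independent {m = m} E =
  (λs : Fin m → ℚ) → (∀ v → linComb λs E v ≡ 0ℚ) → ∀ j → λs j ≡ 0ℚ

ImpliesBy : ∀ {k m} → (Fin m → Eqn k) → Subset m → Eqn k → Set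
ImpliesBy {m = m} S P e =
  Σ (Fin m → ℚ) λ λs → (∀ j → j ∉ P → λs j ≡ 0ℚ) × (∀ v → e v ≡ linComb λs S v)

Implies : ∀ {k m} → (Fin m → Eqn k) → Eqn k → Set
Implies S e = ImpliesBy S ⊤ e

MinImpliesBy : ∀ {k m} → (Fin m → Eqn k) → Subset m → Eqn k → Set
MinImpliesBy S P e = ImpliesBy S P e × (∀ Q → Q ⊂ P → ¬ ImpliesBy S Q e)

Contains : ∀ {k} → Eqn k → Fin k → Set
Contains e v = e v ≢ 0ℚ

numVars : ∀ {k t} → (Fin t → Eqn k) → ℕ
numVars {k} {t} E =
  Σℕ k (λ v → if does (any? (λ j → ¬? (E j v ≟ 0ℚ))) then 1 else 0)

numVars₁ : ∀ {k} → Eqn k → ℕ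
numVars₁ {k} e = Σℕ k (λ v → if does (¬? (e v ≟ 0ℚ)) then 1 else 0)

δ : ∀ {k} → Fin k → Eqn k
δ a v = if does (a Data.Fin.≟ v) then 1ℚ else 0ℚ
  where import Data.Fin

IsDiffEq : ∀ {k} → Eqn k → Set
IsDiffEq {k} e =
  (∃ λ v → e v ≢ 0ℚ) ×
  (∃ λ i₁ → ∃ λ i₂ → ∃ λ i₃ → ∃ λ i₄ →
     ∀ v → e v ≡ ((δ i₁ v - δ i₂ v) - δ i₃ v) + δ i₄ v)

Valid : ∀ {k m} → (Fin m → Eqn k) → Set
Valid S = ∀ a b → a ≢ b → ¬ Implies S (λ v → δ a v - δ b v)

CollinearityFree : ∀ {k m} → (Fin m → Eqn k) → Set
CollinearityFree S = ∀ e → Implies S e → numVars₁ e ≢ 3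

Light : ∀ {k m} → ℚ → (Fin m → Eqn k) → Set
Light {k} c S =
  ∀ (t : ℕ) → 1 ℕ.≤ t → (E : Fin t → Eqn k) → Independent E →
  (∀ j → Implies S (E j)) → c * (+ t / 1) + 1ℚ ≤ (+ numVars E / 1)

Good : ∀ {k m} → ℚ → (Fin m → Eqn k) → Set
Good c S = Valid S × CollinearityFree S × Light c S

StandingParams : (ε : ℚ) (k₀ : ℕ) .{{_ : ℕ.NonZero k₀}} (c : ℚ) → Set
StandingParams ε k₀ c =
  Σ (0ℚ < ε) λ ε>0 →
    (ε ≤ + 1 / 4096) ×
    ((+ 32 / 1) * (1/_ ε {{>-nonZero ε>0}}) * (1/_ ε {{>-nonZero ε>0}}) ≤ (+ k₀ / 1)) ×
    ((+ 2 / 1) - (((ε * ε) * (+ 1 / 32)) ⊓ (+ 2 / k₀)) ≤ c) ×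
    (c ≤ + 2 / 1)

{-# OPTIONS --safe #-}
module Submission where

-- Let P minimally imply the difference equality e, say e = Σ_{j ∈ P} μ_j S_j.
-- Minimality forces every μ_j ≠ 0, and the t = |P| members of P are independent
-- and implied by S, so c-lightness with c ≥ 39/20 puts n ≥ 39t/20 + 1 variables
-- in them. Double counting bounds n from above: a variable occurring in some
-- member of P occurs in e or, being cancelled, in at least two members, while x_i
-- occurs in all t of them; as a difference equality has at most 4 variables, this
-- gives 2n + t ≤ 4t + 4 + 2. The two bounds are incompatible once t ≥ 5.

open import Defs
open import Data.Nat using (ℕ; NonZero; _≤_)
open import Data.Rational using (ℚ; 0ℚ)
open import Data.Fin using (Fin; toℕ; _<_)
open import Data.Fin.Subset using (Subset; ∣_∣)
open import Relation.Binary.PropositionalEquality using (_≡_; _≢_)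

open import Data.Bool using (Bool; true; false; if_then_else_)
open import Data.Empty using (⊥-elim)
open import Data.Fin using (zero; suc)
open import Data.Fin.Properties using (any?; suc-injective) renaming (_≟_ to _≟ᶠ_)
open import Data.Fin.Subset using (_∈_; _∉_; _⊂_; _-_)
open import Data.Fin.Subset.Properties using (∈⊤; drop-there; x∈p⇒p-x⊂p; x∈p∧x≢y⇒x∈p-y)
import Data.Integer as ℤ
import Data.Integer.Properties as ℤ
open import Data.List using ([]) renaming (_∷_ to _∷ₗ_)
open import Data.Nat using (zero; suc; _+_; _*_; z≤n; s≤s; _≤?_)
open import Data.Nat.Properties
  using ( ≤-trans; ≤-reflexive; <-irrefl; ≰⇒>; m≤m+n; m≤n+m; +-comm; +-assoc
        ; *-zeroʳ; *-identityʳ; +-mono-≤; +-monoˡ-≤; +-monoʳ-≤; +-monoˡ-<; +-monoʳ-<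
        ; *-monoʳ-≤; +-commutativeSemigroup; module ≤-Reasoning )
import Data.Nat.Coprimality as Coprime
open import Data.Nat.Tactic.RingSolver using (solve)
open import Algebra.Properties.CommutativeSemigroup +-commutativeSemigroup
  using (interchange; xy∙z≈xz∙y)
open import Data.Product using (∃; _×_; _,_)
import Data.Rational as ℚ
open import Data.Rational using (1ℚ; _/_)
import Data.Rational.Properties as ℚ
import Data.Rational.Unnormalised as ℚᵘ
open import Data.Rational.Unnormalised using (mkℚᵘ)
import Data.Rational.Unnormalised.Properties as ℚᵘ
open import Data.Unit using (tt)
open import Data.Vec using (_∷_; []; here; there)
open import Function using (_∘_)
open import Relation.Binary.PropositionalEquality
  using (refl; sym; trans; cong; cong₂; subst; subst₂; module ≡-Reasoning)
open import Relation.Nullary using (¬_; Dec; yes; no; does; ¬?)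
open import Relation.Nullary.Decidable
  using (dec-true; dec-false; decidable-stable; toWitness; _×-dec_)

χ : Bool → ℕ
χ b = if b then 1 else 0

χ≤1 : ∀ b → χ b ≤ 1
χ≤1 true  = s≤s z≤n
χ≤1 false = z≤n

χ-twice≤ : ∀ {A : Set} (a? : Dec A) {n} → (A → 2 ≤ n) → χ (does a?) + χ (does a?) ≤ n
χ-twice≤ (yes a) 2≤n = 2≤n a
χ-twice≤ (no _)  _   = z≤n

bit : Bool → ℚ
bit b = if b then 1ℚ else 0ℚ

-- numVars₁ e and numVars E unfold to Σℕ k (nz ∘ e) and
-- Σℕ k (λ v → occupied (λ j → E j v)), and δ a v to bit (does (a ≟ᶠ v)).
nz : ℚ → ℕ
nz q = χ (does (¬? (q ℚ.≟ 0ℚ)))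

occupied : ∀ {t} → (Fin t → ℚ) → ℕ
occupied a = χ (does (any? (λ j → ¬? (a j ℚ.≟ 0ℚ))))

nz≤1 : ∀ q → nz q ≤ 1
nz≤1 q = χ≤1 _

nz-≢0 : ∀ q → q ≢ 0ℚ → nz q ≡ 1
nz-≢0 q q≢0 = cong χ (dec-true (¬? (q ℚ.≟ 0ℚ)) q≢0)

occupied≤1 : ∀ {t} (a : Fin t → ℚ) → occupied a ≤ 1
occupied≤1 a = χ≤1 _

δ-diag : ∀ {m} (a : Fin m) → δ a a ≡ 1ℚ
δ-diag a = cong bit (dec-true (a ≟ᶠ a) refl)

δ-off : ∀ {m} {a x : Fin m} → x ≢ a → δ a x ≡ 0ℚ
δ-off {a = a} {x} x≢a = cong bit (dec-false (a ≟ᶠ x) (x≢a ∘ sym))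

Σℕ-cong : ∀ m {f g : Fin m → ℕ} → (∀ x → f x ≡ g x) → Σℕ m f ≡ Σℕ m g
Σℕ-cong zero    f≡g = refl
Σℕ-cong (suc m) f≡g = cong₂ _+_ (f≡g zero) (Σℕ-cong m (f≡g ∘ suc))

Σℕ-mono-≤ : ∀ m {f g : Fin m → ℕ} → (∀ x → f x ≤ g x) → Σℕ m f ≤ Σℕ m g
Σℕ-mono-≤ zero    f≤g = z≤n
Σℕ-mono-≤ (suc m) f≤g = +-mono-≤ (f≤g zero) (Σℕ-mono-≤ m (f≤g ∘ suc))

Σℕ-const : ∀ m b → Σℕ m (λ _ → b) ≡ m * b
Σℕ-const zero    b = refl
Σℕ-const (suc m) b = cong (b +_) (Σℕ-const m b)

Σℕ-distrib-+ : ∀ m (f g : Fin m → ℕ) → Σℕ m (λ x → f x + g x) ≡ Σℕ m f + Σℕ m g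
Σℕ-distrib-+ zero    f g = refl
Σℕ-distrib-+ (suc m) f g =
  trans (cong (f zero + g zero +_) (Σℕ-distrib-+ m (f ∘ suc) (g ∘ suc)))
        (interchange (f zero) (g zero) _ _)

Σℕ-comm : ∀ m n (h : Fin m → Fin n → ℕ) →
  Σℕ m (λ x → Σℕ n (h x)) ≡ Σℕ n (λ y → Σℕ m (λ x → h x y))
Σℕ-comm zero    n h = sym (trans (Σℕ-const n 0) (*-zeroʳ n))
Σℕ-comm (suc m) n h =
  trans (cong (Σℕ n (h zero) +_) (Σℕ-comm m n (h ∘ suc)))
        (sym (Σℕ-distrib-+ n (h zero) _))

Σℕ-term : ∀ m (f : Fin m → ℕ) a → f a ≤ Σℕ m f
Σℕ-term (suc m) f zero    = m≤m+n _ _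
Σℕ-term (suc m) f (suc a) = ≤-trans (Σℕ-term m (f ∘ suc) a) (m≤n+m _ _)

Σℕ-pair : ∀ m (f : Fin m → ℕ) {a b} → a ≢ b → f a + f b ≤ Σℕ m f
Σℕ-pair (suc m) f {zero}  {zero}  a≢b = ⊥-elim (a≢b refl)
Σℕ-pair (suc m) f {zero}  {suc b} a≢b = +-monoʳ-≤ (f zero) (Σℕ-term m (f ∘ suc) b)
Σℕ-pair (suc m) f {suc a} {zero}  a≢b =
  ≤-trans (≤-reflexive (+-comm (f (suc a)) (f zero))) (+-monoʳ-≤ (f zero) (Σℕ-term m (f ∘ suc) a))
Σℕ-pair (suc m) f {suc a} {suc b} a≢b =
  ≤-trans (Σℕ-pair m (f ∘ suc) (a≢b ∘ cong suc)) (m≤n+m _ _)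

Σℕ-mono-at : ∀ m {f g : Fin m → ℕ} (i : Fin m) {r r′} →
  (∀ x → f x ≤ g x) → f i + r ≤ g i + r′ → Σℕ m f + r ≤ Σℕ m g + r′
Σℕ-mono-at (suc m) {f} {g} zero {r} {r′} f≤g at-i = begin
  f zero + Σℕ m (f ∘ suc) + r   ≡⟨ xy∙z≈xz∙y (f zero) _ r ⟩
  f zero + r + Σℕ m (f ∘ suc)   ≤⟨ +-mono-≤ at-i (Σℕ-mono-≤ m (f≤g ∘ suc)) ⟩
  g zero + r′ + Σℕ m (g ∘ suc)  ≡⟨ xy∙z≈xz∙y (g zero) _ r′ ⟨
  g zero + Σℕ m (g ∘ suc) + r′  ∎
  where open ≤-Reasoning
Σℕ-mono-at (suc m) {f} {g} (suc i) {r} {r′} f≤g at-i = begin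
  f zero + Σℕ m (f ∘ suc) + r     ≡⟨ +-assoc (f zero) _ r ⟩
  f zero + (Σℕ m (f ∘ suc) + r)   ≤⟨ +-mono-≤ (f≤g zero) (Σℕ-mono-at m i (f≤g ∘ suc) at-i) ⟩
  g zero + (Σℕ m (g ∘ suc) + r′)  ≡⟨ +-assoc (g zero) _ r′ ⟨
  g zero + Σℕ m (g ∘ suc) + r′    ∎
  where open ≤-Reasoning

Σℕ-χ≟ : ∀ {k} (a : Fin k) → Σℕ k (λ v → χ (does (a ≟ᶠ v))) ≡ 1
Σℕ-χ≟ {suc k} zero    = cong suc (trans (Σℕ-const k 0) (*-zeroʳ k))
Σℕ-χ≟ {suc k} (suc a) = Σℕ-χ≟ a

Σℚ-cong : ∀ m {f g : Fin m → ℚ} → (∀ x → f x ≡ g x) → Σℚ m f ≡ Σℚ m g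
Σℚ-cong zero    f≡g = refl
Σℚ-cong (suc m) f≡g = cong₂ ℚ._+_ (f≡g zero) (Σℚ-cong m (f≡g ∘ suc))

Σℚ-zero : ∀ m {f : Fin m → ℚ} → (∀ x → f x ≡ 0ℚ) → Σℚ m f ≡ 0ℚ
Σℚ-zero zero    f≡0 = refl
Σℚ-zero (suc m) f≡0 = cong₂ ℚ._+_ (f≡0 zero) (Σℚ-zero m (f≡0 ∘ suc))

Σℚ-single : ∀ m (f : Fin m → ℚ) a → (∀ x → x ≢ a → f x ≡ 0ℚ) → Σℚ m f ≡ f a
Σℚ-single (suc m) f zero    f≡0 =
  trans (cong (f zero ℚ.+_) (Σℚ-zero m (λ x → f≡0 (suc x) λ ()))) (ℚ.+-identityʳ (f zero))
Σℚ-single (suc m) f (suc a) f≡0 =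
  trans (cong (ℚ._+ Σℚ m (f ∘ suc)) (f≡0 zero λ ()))
        (trans (ℚ.+-identityˡ _) (Σℚ-single m (f ∘ suc) a (λ x x≢a → f≡0 (suc x) (x≢a ∘ suc-injective))))

Σℚ≡0⇒another≢0 : ∀ m (f : Fin m → ℚ) {a} → Σℚ m f ≡ 0ℚ → f a ≢ 0ℚ → ∃ λ b → b ≢ a × f b ≢ 0ℚ
Σℚ≡0⇒another≢0 m f {a} Σf≡0 fa≢0 with any? (λ b → ¬? (b ≟ᶠ a) ×-dec ¬? (f b ℚ.≟ 0ℚ))
... | yes another = another
... | no  none    = ⊥-elim (fa≢0 (trans (sym (Σℚ-single m f a others)) Σf≡0))
  where
  others : ∀ b → b ≢ a → f b ≡ 0ℚ
  others b b≢a = decidable-stable (f b ℚ.≟ 0ℚ) (λ fb≢0 → none (b , b≢a , fb≢0))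

*-≢0 : ∀ {p q} → p ≢ 0ℚ → q ≢ 0ℚ → p ℚ.* q ≢ 0ℚ
*-≢0 {p} {q} p≢0 q≢0 pq≡0 = q≢0 (begin
  q                     ≡⟨ ℚ.*-identityˡ q ⟨
  1ℚ ℚ.* q              ≡⟨ cong (ℚ._* q) (ℚ.*-inverseˡ p) ⟨
  ℚ.1/ p ℚ.* p ℚ.* q    ≡⟨ ℚ.*-assoc (ℚ.1/ p) p q ⟩
  ℚ.1/ p ℚ.* (p ℚ.* q)  ≡⟨ cong (ℚ.1/ p ℚ.*_) pq≡0 ⟩
  ℚ.1/ p ℚ.* 0ℚ         ≡⟨ ℚ.*-zeroʳ (ℚ.1/ p) ⟩
  0ℚ                    ∎)
  where
  open ≡-Reasoning
  instance _ = ℚ.≢-nonZero p≢0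

enum : ∀ {m} (P : Subset m) → Fin ∣ P ∣ → Fin m
enum (true  ∷ P) zero    = zero
enum (true  ∷ P) (suc j) = suc (enum P j)
enum (false ∷ P) j       = suc (enum P j)

enum∈ : ∀ {m} (P : Subset m) j → enum P j ∈ P
enum∈ (true  ∷ P) zero    = here
enum∈ (true  ∷ P) (suc j) = there (enum∈ P j)
enum∈ (false ∷ P) j       = there (enum∈ P j)

extendByZero : ∀ {m} (P : Subset m) → (Fin ∣ P ∣ → ℚ) → Fin m → ℚ
extendByZero (true  ∷ P) μ zero    = μ zero
extendByZero (true  ∷ P) μ (suc x) = extendByZero P (μ ∘ suc) x
extendByZero (false ∷ P) μ zero    = 0ℚ
extendByZero (false ∷ P) μ (suc x) = extendByZero P μ x

extendByZero-enum : ∀ {m} (P : Subset m) μ j → extendByZero P μ (enum P j) ≡ μ j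
extendByZero-enum (true  ∷ P) μ zero    = refl
extendByZero-enum (true  ∷ P) μ (suc j) = extendByZero-enum P (μ ∘ suc) j
extendByZero-enum (false ∷ P) μ j       = extendByZero-enum P μ j

extendByZero-∉ : ∀ {m} (P : Subset m) μ x → x ∉ P → extendByZero P μ x ≡ 0ℚ
extendByZero-∉ (true  ∷ P) μ zero    x∉P = ⊥-elim (x∉P here)
extendByZero-∉ (true  ∷ P) μ (suc x) x∉P = extendByZero-∉ P (μ ∘ suc) x (x∉P ∘ there)
extendByZero-∉ (false ∷ P) μ zero    x∉P = refl
extendByZero-∉ (false ∷ P) μ (suc x) x∉P = extendByZero-∉ P μ x (x∉P ∘ there)

Σℚ-enum : ∀ {m} (P : Subset m) (g : Fin m → ℚ) → (∀ x → x ∉ P → g x ≡ 0ℚ) →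
  Σℚ m g ≡ Σℚ ∣ P ∣ (g ∘ enum P)
Σℚ-enum []          g g∉≡0 = refl
Σℚ-enum (true  ∷ P) g g∉≡0 =
  cong (g zero ℚ.+_) (Σℚ-enum P (g ∘ suc) (λ x x∉P → g∉≡0 (suc x) (x∉P ∘ drop-there)))
Σℚ-enum (false ∷ P) g g∉≡0 =
  trans (cong (ℚ._+ Σℚ _ (g ∘ suc)) (g∉≡0 zero λ ()))
        (trans (ℚ.+-identityˡ _) (Σℚ-enum P (g ∘ suc) (λ x x∉P → g∉≡0 (suc x) (x∉P ∘ drop-there))))

linComb-enum : ∀ {k m} (P : Subset m) {λs : Fin m → ℚ} (S : Fin m → Eqn k) →
  (∀ x → x ∉ P → λs x ≡ 0ℚ) → ∀ v → linComb λs S v ≡ linComb (λs ∘ enum P) (S ∘ enum P) v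
linComb-enum P {λs} S λs∉≡0 v = Σℚ-enum P (λ x → λs x ℚ.* S x v)
  (λ x x∉P → trans (cong (ℚ._* S x v) (λs∉≡0 x x∉P)) (ℚ.*-zeroˡ (S x v)))

Independent-enum : ∀ {k m} (P : Subset m) {S : Fin m → Eqn k} →
  Independent S → Independent (S ∘ enum P)
Independent-enum P {S} independent μ Σμ≡0 j = begin
  μ j                           ≡⟨ extendByZero-enum P μ j ⟨
  extendByZero P μ (enum P j)   ≡⟨ independent (extendByZero P μ) Σλ≡0 (enum P j) ⟩
  0ℚ                            ∎
  where
  open ≡-Reasoning
  Σλ≡0 : ∀ v → linComb (extendByZero P μ) S v ≡ 0ℚ
  Σλ≡0 v = trans (linComb-enum P S (extendByZero-∉ P μ) v)
    (trans (Σℚ-cong ∣ P ∣ (λ j → cong (ℚ._* S (enum P j) v) (extendByZero-enum P μ j))) (Σμ≡0 v))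

Implies-member : ∀ {k m} (S : Fin m → Eqn k) a → Implies S (S a)
Implies-member {m = m} S a = δ a , (λ x x∉⊤ → ⊥-elim (x∉⊤ ∈⊤)) , λ v → sym (begin
  linComb (δ a) S v  ≡⟨ Σℚ-single m _ a (λ x x≢a →
                          trans (cong (ℚ._* S x v) (δ-off x≢a)) (ℚ.*-zeroˡ (S x v))) ⟩
  δ a a ℚ.* S a v    ≡⟨ cong (ℚ._* S a v) (δ-diag a) ⟩
  1ℚ ℚ.* S a v       ≡⟨ ℚ.*-identityˡ (S a v) ⟩
  S a v              ∎)
  where open ≡-Reasoning

minimal⇒coefficient≢0 : ∀ {k m} {S : Fin m → Eqn k} {P e} ((λs , _) : ImpliesBy S P e) →
  (∀ Q → Q ⊂ P → ¬ ImpliesBy S Q e) → ∀ j → j ∈ P → λs j ≢ 0ℚ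
minimal⇒coefficient≢0 {P = P} (λs , λs∉≡0 , e≡) minimal j j∈P λsj≡0 =
  minimal (P - j) (x∈p⇒p-x⊂p j∈P) (λs , λs∉≡0′ , e≡)
  where
  λs∉≡0′ : ∀ x → x ∉ P - j → λs x ≡ 0ℚ
  λs∉≡0′ x x∉P-j with x ≟ᶠ j
  ... | yes refl = λsj≡0
  ... | no  x≢j  = λs∉≡0 x (λ x∈P → x∉P-j (x∈p∧x≢y⇒x∈p-y x∈P x≢j))

signedBits : Bool → Bool → Bool → Bool → ℚ
signedBits p q r s = ((bit p ℚ.- bit q) ℚ.- bit r) ℚ.+ bit s

nz-signedBits : ∀ p q r s → nz (signedBits p q r s) ≤ χ p + (χ q + (χ r + χ s))
nz-signedBits true  q     r     s     = ≤-trans (nz≤1 (signedBits true q r s)) (m≤m+n 1 _)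
nz-signedBits false true  r     s     = ≤-trans (nz≤1 (signedBits false true r s)) (m≤m+n 1 _)
nz-signedBits false false true  s     = ≤-trans (nz≤1 (signedBits false false true s)) (m≤m+n 1 _)
nz-signedBits false false false true  = nz≤1 (signedBits false false false true)
nz-signedBits false false false false = z≤n

numVars₁-diffEq : ∀ {k} {e : Eqn k} → IsDiffEq e → numVars₁ e ≤ 4
numVars₁-diffEq {k} {e} (_ , i₁ , i₂ , i₃ , i₄ , e≡) = begin
  numVars₁ e
    ≤⟨ Σℕ-mono-≤ k pointwise ⟩
  Σℕ k (λ v → [ i₁ ] v + ([ i₂ ] v + ([ i₃ ] v + [ i₄ ] v)))
    ≡⟨ Σℕ-distrib-+ k [ i₁ ] _ ⟩
  Σℕ k [ i₁ ] + Σℕ k (λ v → [ i₂ ] v + ([ i₃ ] v + [ i₄ ] v))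
    ≡⟨ cong (Σℕ k [ i₁ ] +_) (Σℕ-distrib-+ k [ i₂ ] _) ⟩
  Σℕ k [ i₁ ] + (Σℕ k [ i₂ ] + Σℕ k (λ v → [ i₃ ] v + [ i₄ ] v))
    ≡⟨ cong (λ n → Σℕ k [ i₁ ] + (Σℕ k [ i₂ ] + n)) (Σℕ-distrib-+ k [ i₃ ] [ i₄ ]) ⟩
  Σℕ k [ i₁ ] + (Σℕ k [ i₂ ] + (Σℕ k [ i₃ ] + Σℕ k [ i₄ ]))
    ≡⟨ cong₂ _+_ (Σℕ-χ≟ i₁) (cong₂ _+_ (Σℕ-χ≟ i₂) (cong₂ _+_ (Σℕ-χ≟ i₃) (Σℕ-χ≟ i₄))) ⟩
  4 ∎
  where
  open ≤-Reasoning
  [_] : Fin k → Fin k → ℕ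
  [ a ] v = χ (does (a ≟ᶠ v))
  pointwise : ∀ v → nz (e v) ≤ [ i₁ ] v + ([ i₂ ] v + ([ i₃ ] v + [ i₄ ] v))
  pointwise v = ≤-trans (≤-reflexive (cong nz (e≡ v)))
    (nz-signedBits (does (i₁ ≟ᶠ v)) (does (i₂ ≟ᶠ v)) (does (i₃ ≟ᶠ v)) (does (i₄ ≟ᶠ v)))

numVars₁-full : ∀ {t} (a : Fin t → ℚ) → (∀ j → a j ≢ 0ℚ) → numVars₁ a ≡ t
numVars₁-full {t} a a≢0 =
  trans (Σℕ-cong t (λ j → nz-≢0 (a j) (a≢0 j))) (trans (Σℕ-const t 1) (*-identityʳ t))

-- If the combination vanishes, the nonzero entry aⱼ must be cancelled by a second one.
occupied⇒2≤numVars₁+nz : ∀ {t} (μ a : Fin t → ℚ) → (∀ j → μ j ≢ 0ℚ) → (∃ λ j → a j ≢ 0ℚ) →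
  2 ≤ numVars₁ a + nz (Σℚ t (λ j → μ j ℚ.* a j))
occupied⇒2≤numVars₁+nz {t} μ a μ≢0 (j , aj≢0) with Σℚ t (λ j → μ j ℚ.* a j) ℚ.≟ 0ℚ
... | no _ =
  +-monoˡ-≤ 1 (≤-trans (≤-reflexive (sym (nz-≢0 (a j) aj≢0))) (Σℕ-term t (nz ∘ a) j))
... | yes Σ≡0 with Σℚ≡0⇒another≢0 t (λ j → μ j ℚ.* a j) Σ≡0 (*-≢0 (μ≢0 j) aj≢0)
...   | j′ , j′≢j , μaj′≢0 = begin
  1 + 1                  ≡⟨ cong₂ _+_ (nz-≢0 (a j) aj≢0) (nz-≢0 (a j′) aj′≢0) ⟨
  nz (a j) + nz (a j′)   ≤⟨ Σℕ-pair t (nz ∘ a) (j′≢j ∘ sym) ⟩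
  numVars₁ a             ≤⟨ m≤m+n _ 0 ⟩
  numVars₁ a + 0         ∎
  where
  open ≤-Reasoning
  aj′≢0 : a j′ ≢ 0ℚ
  aj′≢0 aj′≡0 = μaj′≢0 (trans (cong (μ j′ ℚ.*_) aj′≡0) (ℚ.*-zeroʳ (μ j′)))

double-count : ∀ {k t} (E : Fin t → Eqn k) (μ : Fin t → ℚ) (e : Eqn k) (i : Fin k) →
  (∀ j → μ j ≢ 0ℚ) → (∀ v → e v ≡ linComb μ E v) → (∀ j → E j i ≢ 0ℚ) →
  numVars E + numVars E + t ≤ Σℕ t (λ j → numVars₁ (E j)) + numVars₁ e + 2
double-count {k} {t} E μ e i μ≢0 e≡ E∋i = begin
  numVars E + numVars E + t
    ≡⟨ cong (_+ t) (Σℕ-distrib-+ k occ occ) ⟨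
  Σℕ k (λ v → occ v + occ v) + t
    ≤⟨ Σℕ-mono-at k i per-variable at-i ⟩
  Σℕ k (λ v → numVars₁ (column v) + nz (e v)) + 2
    ≡⟨ cong (_+ 2) (Σℕ-distrib-+ k (numVars₁ ∘ column) (nz ∘ e)) ⟩
  Σℕ k (numVars₁ ∘ column) + numVars₁ e + 2
    ≡⟨ cong (λ n → n + numVars₁ e + 2) (Σℕ-comm k t (λ v j → nz (E j v))) ⟩
  Σℕ t (λ j → numVars₁ (E j)) + numVars₁ e + 2 ∎
  where
  open ≤-Reasoning
  column : Fin k → Fin t → ℚ
  column v j = E j v
  occ : Fin k → ℕ
  occ v = occupied (column v)
  per-variable : ∀ v → occ v + occ v ≤ numVars₁ (column v) + nz (e v)
  per-variable v = χ-twice≤ (any? _) λ nonzero →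
    subst (λ q → 2 ≤ numVars₁ (column v) + nz q) (sym (e≡ v))
          (occupied⇒2≤numVars₁+nz μ (column v) μ≢0 nonzero)
  at-i : occ i + occ i + t ≤ numVars₁ (column i) + nz (e i) + 2
  at-i = begin
    occ i + occ i + t                   ≤⟨ +-monoˡ-≤ t (+-mono-≤ (occupied≤1 (column i)) (occupied≤1 (column i))) ⟩
    2 + t                               ≡⟨ +-comm 2 t ⟩
    t + 2                               ≡⟨ cong (_+ 2) (numVars₁-full (column i) E∋i) ⟨
    numVars₁ (column i) + 2             ≤⟨ +-monoˡ-≤ 2 (m≤m+n _ _) ⟩
    numVars₁ (column i) + nz (e i) + 2  ∎

39/20≤c : ∀ {ε k₀ c} .{{_ : NonZero k₀}} → StandingParams ε k₀ c → ℤ.+ 39 / 20 ℚ.≤ c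
39/20≤c {ε} {k₀} {c} (ε>0 , ε≤1/4096 , _ , c≥ , _) = begin
  ℤ.+ 39 / 20
    ≤⟨ toWitness {a? = ℤ.+ 39 / 20 ℚ.≤? ℤ.+ 2 / 1 ℚ.- ℤ.+ 1 / 32} tt ⟩
  ℤ.+ 2 / 1 ℚ.- ℤ.+ 1 / 32
    ≤⟨ ℚ.+-monoʳ-≤ (ℤ.+ 2 / 1) (ℚ.neg-antimono-≤ min≤1/32) ⟩
  ℤ.+ 2 / 1 ℚ.- ((ε ℚ.* ε) ℚ.* (ℤ.+ 1 / 32)) ℚ.⊓ (ℤ.+ 2 / k₀)
    ≤⟨ c≥ ⟩
  c ∎
  where
  open ℚ.≤-Reasoning
  instance _ = ℚ.nonNegative (ℚ.<⇒≤ ε>0)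
  ε≤1 : ε ℚ.≤ 1ℚ
  ε≤1 = ℚ.≤-trans ε≤1/4096 (toWitness {a? = ℤ.+ 1 / 4096 ℚ.≤? 1ℚ} tt)
  ε²≤1 : ε ℚ.* ε ℚ.≤ 1ℚ
  ε²≤1 = ℚ.≤-trans (ℚ.*-monoˡ-≤-nonNeg ε ε≤1) (ℚ.≤-trans (ℚ.≤-reflexive (ℚ.*-identityʳ ε)) ε≤1)
  min≤1/32 : (ε ℚ.* ε) ℚ.* (ℤ.+ 1 / 32) ℚ.⊓ (ℤ.+ 2 / k₀) ℚ.≤ ℤ.+ 1 / 32
  min≤1/32 = ℚ.≤-trans (ℚ.p⊓q≤p _ _) (ℚ.*-monoʳ-≤-nonNeg (ℤ.+ 1 / 32) ε²≤1)

toℚᵘ-ℕ : ∀ n → ℚ.toℚᵘ (ℤ.+ n / 1) ≡ mkℚᵘ (ℤ.+ n) 0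
toℚᵘ-ℕ n = cong ℚ.toℚᵘ (ℚ.normalize-coprime (Coprime.sym (Coprime.1-coprimeTo n)))

light⇒39t+20≤n*20 : ∀ {c} t n → ℤ.+ 39 / 20 ℚ.≤ c → c ℚ.* (ℤ.+ t / 1) ℚ.+ 1ℚ ℚ.≤ ℤ.+ n / 1 →
  39 * t + 20 ≤ n * 20
light⇒39t+20≤n*20 t n 39/20≤c light = ℤ.drop‿+≤+ (subst₂ ℤ._≤_ lhs rhs (ℚᵘ.drop-*≤* boundᵘ))
  where
  instance _ = ℚ.normalize-nonNeg t 1
  bound : ℤ.+ 39 / 20 ℚ.* (ℤ.+ t / 1) ℚ.+ 1ℚ ℚ.≤ ℤ.+ n / 1
  bound = ℚ.≤-trans (ℚ.+-monoˡ-≤ 1ℚ (ℚ.*-monoʳ-≤-nonNeg (ℤ.+ t / 1) 39/20≤c)) light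
  boundᵘ : mkℚᵘ (ℤ.+ 39) 19 ℚᵘ.* mkℚᵘ (ℤ.+ t) 0 ℚᵘ.+ ℚᵘ.1ℚᵘ ℚᵘ.≤ mkℚᵘ (ℤ.+ n) 0
  boundᵘ = begin
    mkℚᵘ (ℤ.+ 39) 19 ℚᵘ.* mkℚᵘ (ℤ.+ t) 0 ℚᵘ.+ ℚᵘ.1ℚᵘ
      ≡⟨ cong (λ x → mkℚᵘ (ℤ.+ 39) 19 ℚᵘ.* x ℚᵘ.+ ℚᵘ.1ℚᵘ) (toℚᵘ-ℕ t) ⟨
    ℚ.toℚᵘ (ℤ.+ 39 / 20) ℚᵘ.* ℚ.toℚᵘ (ℤ.+ t / 1) ℚᵘ.+ ℚ.toℚᵘ 1ℚ
      ≃⟨ ℚᵘ.+-congˡ _ (ℚ.toℚᵘ-homo-* (ℤ.+ 39 / 20) (ℤ.+ t / 1)) ⟨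
    ℚ.toℚᵘ (ℤ.+ 39 / 20 ℚ.* (ℤ.+ t / 1)) ℚᵘ.+ ℚ.toℚᵘ 1ℚ
      ≃⟨ ℚ.toℚᵘ-homo-+ (ℤ.+ 39 / 20 ℚ.* (ℤ.+ t / 1)) 1ℚ ⟨
    ℚ.toℚᵘ (ℤ.+ 39 / 20 ℚ.* (ℤ.+ t / 1) ℚ.+ 1ℚ)
      ≤⟨ ℚ.toℚᵘ-mono-≤ bound ⟩
    ℚ.toℚᵘ (ℤ.+ n / 1)
      ≡⟨ toℚᵘ-ℕ n ⟩
    mkℚᵘ (ℤ.+ n) 0 ∎
    where open ℚᵘ.≤-Reasoning
  lhs : ((ℤ.+ 39 ℤ.* ℤ.+ t) ℤ.* ℤ.+ 1 ℤ.+ ℤ.+ 1 ℤ.* ℤ.+ 20) ℤ.* ℤ.+ 1 ≡ ℤ.+ (39 * t + 20)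
  lhs = trans (ℤ.*-identityʳ _) (cong (ℤ._+ ℤ.+ 20) (trans (ℤ.*-identityʳ _) (sym (ℤ.pos-* 39 t))))
  rhs : ℤ.+ n ℤ.* ℤ.+ 20 ≡ ℤ.+ (n * 20)
  rhs = sym (ℤ.pos-* n 20)

at-most-four : ∀ t n → n + n + t ≤ t * 4 + 4 + 2 → (1 ≤ t → 39 * t + 20 ≤ n * 20) → t ≤ 4
at-most-four t n count light with t ≤? 4
... | yes t≤4 = t≤4
... | no  t≰4 = ⊥-elim (<-irrefl refl (begin-strict
  40 * t + 60           <⟨ +-monoʳ-< (40 * t) (+-monoˡ-< 20 (≤-trans (m≤m+n 41 4) (*-monoʳ-≤ 9 5≤t))) ⟩
  40 * t + (9 * t + 20) ≡⟨ solve (t ∷ₗ []) ⟩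
  39 * t + 20 + 10 * t  ≤⟨ +-monoˡ-≤ (10 * t) (light (≤-trans (s≤s z≤n) 5≤t)) ⟩
  n * 20 + 10 * t       ≡⟨ solve (t ∷ₗ n ∷ₗ []) ⟩
  10 * (n + n + t)      ≤⟨ *-monoʳ-≤ 10 count ⟩
  10 * (t * 4 + 4 + 2)  ≡⟨ solve (t ∷ₗ []) ⟩
  40 * t + 60           ∎))
  where
  open ≤-Reasoning
  5≤t : 5 ≤ t
  5≤t = ≰⇒> t≰4

lemma6p1 : (ε : ℚ) (k₀ : ℕ) .{{_ : NonZero k₀}} (c : ℚ) → StandingParams ε k₀ c →
    (k : ℕ) → 1 ≤ k → (i : Fin k) → (s : ℕ) →
    (m : ℕ) (S : Fin m → Eqn k) →
    Good c S → Independent S → (∀ j → IsDiffEq (S j)) →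
    (∀ j → S j i ≢ 0ℚ) → (∀ j v → i < v → S j v ≡ 0ℚ) →
    m ≤ s →
    (P : Subset m) (e : Eqn k) → IsDiffEq e → MinImpliesBy S P e →
    ∣ P ∣ ≤ 4
lemma6p1 ε k₀ c params k _ i s m S (_ , _ , light) independent diffEqs S∋xᵢ _ _
         P e diffEq (implied@(λs , λs∉≡0 , e≡) , minimal) =
  at-most-four ∣ P ∣ (numVars E) counting lightness
  where
  E : Fin ∣ P ∣ → Eqn k
  E = S ∘ enum P
  counting : numVars E + numVars E + ∣ P ∣ ≤ ∣ P ∣ * 4 + 4 + 2
  counting = ≤-trans
    (double-count E (λs ∘ enum P) e i
      (λ j → minimal⇒coefficient≢0 implied minimal (enum P j) (enum∈ P j))
      (λ v → trans (e≡ v) (linComb-enum P S λs∉≡0 v))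
      (S∋xᵢ ∘ enum P))
    (+-monoˡ-≤ 2 (+-mono-≤
      (≤-trans (Σℕ-mono-≤ ∣ P ∣ (numVars₁-diffEq ∘ diffEqs ∘ enum P)) (≤-reflexive (Σℕ-const ∣ P ∣ 4)))
      (numVars₁-diffEq diffEq)))
  lightness : 1 ≤ ∣ P ∣ → 39 * ∣ P ∣ + 20 ≤ numVars E * 20
  lightness 1≤∣P∣ = light⇒39t+20≤n*20 ∣ P ∣ (numVars E) (39/20≤c params)
    (light ∣ P ∣ 1≤∣P∣ E (Independent-enum P independent) (Implies-member S ∘ enum P))
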